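{- Let $3\le m<n\le 2^m$ and let $\vec K$ be an orientation of $K_{m,n}$, with bipartition $X=\{x_1,\dots,x_m\}$, $Y=\{y_1,\dots,y_n\}$, containing no full twins. If there exist two indices $i<i'$ in $\{1,\dots,m\}$ such that $w^i=w^{i'}$ for every word $w=w^1\cdots w^m\in W(\vec K)$, then $\vec K$ is not rigid. In particular, if $m\ge 3$ and $0\le k<\log_2(m)$, then $K_{m,2^m-k}$ does not admit any rigid orientation.
   Context: $K_{m,n}$ is the complete bipartite graph with parts of sizes $m$ and $n$. An orientation assigns one direction to each edge. For a vertex $u$, $N^+(u)$ is its set of out-neighbours; two vertices $u,v$ are full twins if $N^+(u)=N^+(v)$. To each vertex $y\in Y$ associate the word $b^1\cdots b^m\in\{0,1\}^m$ where $b^j=0$ if $x_jy$ is an arc and $b^j=1$ otherwise (i.e. if $yx_j$ is an arc). When $\vec K$ has no full twins, distinct vertices of $Y$ have distinct words, and $W(\vec K)\subseteq\{0,1\}^m$ denotes the set of the $2^m-n$ words of $\{0,1\}^m$ that are not associated with any vertex of $Y$. An automorphism of an oriented graph is a permutation $\phi$ of its vertices such that $\phi(u)\phi(v)$ is an arc whenever $uv$ is an arc; the oriented graph is rigid if its only automorphism is the identity. -}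

module Defs where

open import Data.Nat using (ℕ)
open import Data.Fin using (Fin)
open import Data.Bool using (Bool; true; false; not)
open import Data.Sum using (_⊎_; inj₁; inj₂)
open import Data.Product using (_×_)
open import Data.Empty using (⊥)
open import Relation.Binary.PropositionalEquality using (_≡_; _≢_)
open import Relation.Nullary using (¬_)
open import Function.Bundles using (_↔_; Inverse)

-- An orientation of K_{m,n} with X = Fin m (x_j) and Y = Fin n (y).
-- xToY j y = true  iff  x_j y is an arc;  false iff  y x_j is an arc.
Orientation : ℕ → ℕ → Set
Orientation m n = Fin m → Fin n → Bool

Vertex : ℕ → ℕ → Set
Vertex m n = Fin m ⊎ Fin n

Arc : ∀ {m n} → Orientation m n → Vertex m n → Vertex m n → Set
Arc o (inj₁ j) (inj₂ y) = o j y ≡ true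
Arc o (inj₂ y) (inj₁ j) = o j y ≡ false
Arc o (inj₁ _) (inj₁ _) = ⊥
Arc o (inj₂ _) (inj₂ _) = ⊥

FullTwins : ∀ {m n} → Orientation m n → Vertex m n → Vertex m n → Set
FullTwins o u v = u ≢ v × (∀ w → (Arc o u w → Arc o v w) × (Arc o v w → Arc o u w))

NoFullTwins : ∀ {m n} → Orientation m n → Set
NoFullTwins o = ∀ u v → ¬ FullTwins o u v

-- Words are functions Fin m → Bool (false = 0, true = 1).
Word : ℕ → Set
Word m = Fin m → Bool

-- word of y: b^j = 0 iff x_j y is an arc.
wordOf : ∀ {m n} → Orientation m n → Fin n → Word m
wordOf o y j = not (o j y)

InW : ∀ {m n} → Orientation m n → Word m → Set
InW o w = ∀ y → ¬ (∀ j → wordOf o y j ≡ w j)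

IsAutomorphism : ∀ {m n} → Orientation m n → (Vertex m n ↔ Vertex m n) → Set
IsAutomorphism o φ = ∀ u v → Arc o u v → Arc o (Inverse.to φ u) (Inverse.to φ v)

Rigid : ∀ {m n} → Orientation m n → Set
Rigid {m} {n} o = (φ : Vertex m n ↔ Vertex m n) → IsAutomorphism o φ →
  ∀ v → Inverse.to φ v ≡ v

module Submission where

-- An automorphism is obtained from a permutation π of X together
-- with a permutation τ of Y such that o (π j) (τ y) = o j y.  If the words of
-- the vertices of Y are pairwise distinct, any permutation π of X fixing every
-- word of W(K) pointwise (w ∘ π = w) extends to such a τ: the set of words of Y
-- is the complement of W(K), hence also closed under w ↦ w ∘ π⁻¹, and τ sends y
-- to the vertex whose word is (word y) ∘ π⁻¹.  The first claim follows by taking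
-- for π the transposition of the two indices i < i′.  For the second claim,
-- either two vertices of Y share a word (and swapping them is an automorphism)
-- or the words are distinct; then |W(K)| ≤ k, and since the columns
-- j ↦ (w j)_{w ∈ W(K)} take at most 2^k < m values, the pigeonhole principle
-- yields two indices on which every word of W(K) agrees, so the first claim
-- applies.

open import Defs
open import Data.Nat using (ℕ; _≤_; _<_; _^_; _∸_)
open import Data.Fin using (Fin) renaming (_<_ to _<ᶠ_)
open import Data.Product using (_×_; ∃-syntax)
open import Relation.Binary.PropositionalEquality using (_≡_)
open import Relation.Nullary using (¬_)

open import Data.Nat using (_+_)
import Data.Nat.Properties as ℕ
open import Data.Fin using (zero; suc; funToFin; finToFun; splitAt)
open import Data.Fin.Properties using (2↔Bool; finToFun-funToFin; +↔⊎; <⇒≢; pigeonhole; injective⇒≤; any?; all?)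
  renaming (_≟_ to _≟ᶠ_)
import Data.Fin.Permutation.Components as PC
open import Data.Fin.Permutation using (Permutation′; _⟨$⟩ʳ_; _⟨$⟩ˡ_; inverseˡ; inverseʳ; flip; transpose; permutation)
  renaming (id to idₚ)
open import Data.Bool.Properties using (not-injective) renaming (_≟_ to _≟ᵇ_)
open import Data.Sum using (_⊎_; inj₁; inj₂; [_,_]′)
open import Data.Sum.Properties using (inj₁-injective; inj₂-injective)
open import Data.Sum.Function.Propositional using (_⊎-↔_)
open import Data.Product using (_,_; proj₁; proj₂; ∃)
open import Data.Empty using (⊥-elim)
open import Data.List using (List; filter; length; lookup; map; allFin)
open import Data.List.Properties using (length-map)
open import Data.List.Membership.Propositional using (_∈_)
open import Data.List.Membership.Propositional.Properties using (∈-lookup; ∈-filter⁺; ∈-filter⁻; ∈-allFin; ∈-map⁺)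
import Data.List.Relation.Unary.All as All
open import Data.List.Relation.Unary.AllPairs using (_∷_)
open import Data.List.Relation.Unary.Any using (index)
open import Data.List.Relation.Unary.Any.Properties using (lookup-index)
open import Data.List.Relation.Unary.Unique.Propositional using (Unique)
import Data.List.Relation.Unary.Unique.Propositional.Properties as Unique
open import Relation.Binary.PropositionalEquality using (refl; sym; trans; cong; _≢_; _≗_; module ≡-Reasoning)
open import Relation.Nullary using (Dec; yes; no; ¬?)
open import Relation.Nullary.Decidable using (_×-dec_)
open import Function using (_∘_)
open import Function.Bundles using (Inverse; Injection)
open import Function.Properties.Inverse using (↔⇒↣)

Compatible : ∀ {m n} → Orientation m n → Permutation′ m → Permutation′ n → Set
Compatible o π τ = ∀ j y → o (π ⟨$⟩ʳ j) (τ ⟨$⟩ʳ y) ≡ o j y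

compatible⇒automorphism : ∀ {m n} (o : Orientation m n) (π : Permutation′ m) (τ : Permutation′ n) →
  Compatible o π τ → IsAutomorphism o (π ⊎-↔ τ)
compatible⇒automorphism o π τ compat (inj₁ j) (inj₂ y) arc = trans (compat j y) arc
compatible⇒automorphism o π τ compat (inj₂ y) (inj₁ j) arc = trans (compat j y) arc

compatible⇒¬Rigid : ∀ {m n} (o : Orientation m n) (π : Permutation′ m) (τ : Permutation′ n) →
  Compatible o π τ → (v : Vertex m n) → Inverse.to (π ⊎-↔ τ) v ≢ v → ¬ Rigid o
compatible⇒¬Rigid o π τ compat v moved rigid =
  moved (rigid (π ⊎-↔ τ) (compatible⇒automorphism o π τ compat) v)

transpose-resp : ∀ {n} {B : Set} (f : Fin n → B) {i j : Fin n} → f i ≡ f j →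
  ∀ k → f (PC.transpose i j k) ≡ f k
transpose-resp f {i} {j} fi≡fj k with k ≟ᶠ i
... | yes refl = sym fi≡fj
... | no _ with k ≟ᶠ j
...   | yes refl = fi≡fj
...   | no _ = refl

transpose-sends : ∀ {n} (i j : Fin n) → PC.transpose i j i ≡ j
transpose-sends i j with i ≟ᶠ i
... | yes _ = refl
... | no i≢i = ⊥-elim (i≢i refl)

sameWord⇒¬Rigid : ∀ {m n} (o : Orientation m n) {y y′ : Fin n} →
  y ≢ y′ → wordOf o y ≗ wordOf o y′ → ¬ Rigid o
sameWord⇒¬Rigid o {y} {y′} y≢y′ same =
  compatible⇒¬Rigid o idₚ (transpose y y′) compat (inj₂ y) moved
  where
  compat : Compatible o idₚ (transpose y y′)
  compat j = transpose-resp (o j) (not-injective (same j))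
  moved : inj₂ (PC.transpose y y′ y) ≢ inj₂ y
  moved eq = y≢y′ (sym (trans (sym (transpose-sends y y′)) (inj₂-injective eq)))

WordInjective : ∀ {m n} → Orientation m n → Set
WordInjective o = ∀ y y′ → wordOf o y ≗ wordOf o y′ → y ≡ y′

noFullTwins⇒wordInjective : ∀ {m n} (o : Orientation m n) → NoFullTwins o → WordInjective o
noFullTwins⇒wordInjective o noTwins y y′ same with y ≟ᶠ y′
... | yes y≡y′ = y≡y′
... | no y≢y′ = ⊥-elim (noTwins (inj₂ y) (inj₂ y′) ((λ eq → y≢y′ (inj₂-injective eq)) , sameOut))
  where
  sameOut : ∀ w → (Arc o (inj₂ y) w → Arc o (inj₂ y′) w) × (Arc o (inj₂ y′) w → Arc o (inj₂ y) w)
  sameOut (inj₁ j) = trans (sym (not-injective (same j))) , trans (not-injective (same j))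
  sameOut (inj₂ _) = (λ ()) , (λ ())

wordInjective-or-sameWord : ∀ {m n} (o : Orientation m n) →
  WordInjective o ⊎ ∃[ y ] ∃[ y′ ] (y ≢ y′ × wordOf o y ≗ wordOf o y′)
wordInjective-or-sameWord o
  with any? (λ y → any? (λ y′ → ¬? (y ≟ᶠ y′) ×-dec all? (λ j → wordOf o y j ≟ᵇ wordOf o y′ j)))
... | yes (y , y′ , pair) = inj₂ (y , y′ , pair)
... | no noPair = inj₁ injective
  where
  injective : WordInjective o
  injective y y′ same with y ≟ᶠ y′
  ... | yes y≡y′ = y≡y′
  ... | no y≢y′ = ⊥-elim (noPair (y , y′ , y≢y′ , same))

IsWord : ∀ {m n} → Orientation m n → Word m → Set
IsWord o u = ∃ λ y → wordOf o y ≗ u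

isWord? : ∀ {m n} (o : Orientation m n) (u : Word m) → Dec (IsWord o u)
isWord? o u = any? (λ y → all? (λ j → wordOf o y j ≟ᵇ u j))

FixesW : ∀ {m n} → Orientation m n → Permutation′ m → Set
FixesW o π = ∀ w → InW o w → ∀ j → w (π ⟨$⟩ʳ j) ≡ w j

fixesW-flip : ∀ {m n} (o : Orientation m n) (π : Permutation′ m) → FixesW o π → FixesW o (flip π)
fixesW-flip o π fix w w∈W j = trans (sym (fix w w∈W (π ⟨$⟩ˡ j))) (cong w (inverseʳ π))

wordsClosed : ∀ {m n} (o : Orientation m n) (π : Permutation′ m) → FixesW o π →
  ∀ y → IsWord o (wordOf o y ∘ (π ⟨$⟩ˡ_))
wordsClosed o π fix y with isWord? o (wordOf o y ∘ (π ⟨$⟩ˡ_))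
... | yes isWord = isWord
... | no notWord = ⊥-elim (u∈W y λ j → trans (cong (wordOf o y) (sym (inverseˡ π))) (fix u u∈W j))
  where
  u : Word _
  u = wordOf o y ∘ (π ⟨$⟩ˡ_)
  u∈W : InW o u
  u∈W y′ same = notWord (y′ , same)

fixesW⇒compatible : ∀ {m n} (o : Orientation m n) → WordInjective o →
  (π : Permutation′ m) → FixesW o π → ∃ λ τ → Compatible o π τ
fixesW⇒compatible {m} {n} o injective π fix = τ , compat
  where
  open ≡-Reasoning
  shift unshift : Fin n → Fin n
  shift y = proj₁ (wordsClosed o π fix y)
  unshift y = proj₁ (wordsClosed o (flip π) (fixesW-flip o π fix) y)
  shift-word : ∀ y j → wordOf o (shift y) j ≡ wordOf o y (π ⟨$⟩ˡ j)
  shift-word y = proj₂ (wordsClosed o π fix y)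
  unshift-word : ∀ y j → wordOf o (unshift y) j ≡ wordOf o y (π ⟨$⟩ʳ j)
  unshift-word y = proj₂ (wordsClosed o (flip π) (fixesW-flip o π fix) y)
  shift-unshift : ∀ y → shift (unshift y) ≡ y
  shift-unshift y = injective _ _ λ j → begin
    wordOf o (shift (unshift y)) j          ≡⟨ shift-word (unshift y) j ⟩
    wordOf o (unshift y) (π ⟨$⟩ˡ j)         ≡⟨ unshift-word y (π ⟨$⟩ˡ j) ⟩
    wordOf o y (π ⟨$⟩ʳ (π ⟨$⟩ˡ j))          ≡⟨ cong (wordOf o y) (inverseʳ π) ⟩
    wordOf o y j                            ∎
  unshift-shift : ∀ y → unshift (shift y) ≡ y
  unshift-shift y = injective _ _ λ j → begin
    wordOf o (unshift (shift y)) j          ≡⟨ unshift-word (shift y) j ⟩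
    wordOf o (shift y) (π ⟨$⟩ʳ j)           ≡⟨ shift-word y (π ⟨$⟩ʳ j) ⟩
    wordOf o y (π ⟨$⟩ˡ (π ⟨$⟩ʳ j))          ≡⟨ cong (wordOf o y) (inverseˡ π) ⟩
    wordOf o y j                            ∎
  τ : Permutation′ n
  τ = permutation shift unshift shift-unshift unshift-shift
  compat : Compatible o π τ
  compat j y = not-injective (trans (shift-word y (π ⟨$⟩ʳ j)) (cong (wordOf o y) (inverseˡ π)))

fixesW⇒¬Rigid : ∀ {m n} (o : Orientation m n) → WordInjective o →
  (π : Permutation′ m) → FixesW o π → (i : Fin m) → π ⟨$⟩ʳ i ≢ i → ¬ Rigid o
fixesW⇒¬Rigid o injective π fix i moved with fixesW⇒compatible o injective π fix
... | τ , compat = compatible⇒¬Rigid o π τ compat (inj₁ i) (moved ∘ inj₁-injective)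

agreeingIndices⇒¬Rigid : ∀ {m n} (o : Orientation m n) → WordInjective o →
  {i i′ : Fin m} → i ≢ i′ → (∀ w → InW o w → w i ≡ w i′) → ¬ Rigid o
agreeingIndices⇒¬Rigid o injective {i} {i′} i≢i′ agree =
  fixesW⇒¬Rigid o injective (transpose i i′) (λ w w∈W → transpose-resp w (agree w w∈W)) i
    (λ eq → i≢i′ (trans (sym eq) (transpose-sends i i′)))

encode : ∀ {m} → Word m → Fin (2 ^ m)
encode w = funToFin (Inverse.from 2↔Bool ∘ w)

decode : ∀ {m} → Fin (2 ^ m) → Word m
decode c = Inverse.to 2↔Bool ∘ finToFun c

decode-encode : ∀ {m} (w : Word m) → decode (encode w) ≗ w
decode-encode w j =
  trans (cong (Inverse.to 2↔Bool) (finToFun-funToFin _ j)) (Inverse.strictlyInverseˡ 2↔Bool (w j))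

columnCode : ∀ {m} (ws : List (Word m)) → Fin m → Fin (2 ^ length ws)
columnCode ws j = encode (λ l → lookup ws l j)

-- If m exceeds 2 ^ (number of words), two coordinates agree on all of them,
-- since by the pigeonhole principle two columns have the same code.
columns-collide : ∀ {m} (ws : List (Word m)) → 2 ^ length ws < m →
  ∃[ i ] ∃[ i′ ] (i <ᶠ i′ × (∀ {w} → w ∈ ws → w i ≡ w i′))
columns-collide ws small with pigeonhole small (columnCode ws)
... | i , i′ , i<i′ , sameColumn = i , i′ , i<i′ , agree
  where
  open ≡-Reasoning
  agree : ∀ {w} → w ∈ ws → w i ≡ w i′
  agree {w} w∈ws = begin
    w i                                            ≡⟨ cong (λ u → u i) (lookup-index w∈ws) ⟩
    lookup ws l i                                  ≡⟨ sym (decode-encode (λ l → lookup ws l i) l) ⟩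
    decode (encode (λ l → lookup ws l i)) l        ≡⟨ cong (λ c → decode c l) sameColumn ⟩
    decode (encode (λ l → lookup ws l i′)) l       ≡⟨ decode-encode (λ l → lookup ws l i′) l ⟩
    lookup ws l i′                                 ≡⟨ cong (λ u → u i′) (sym (lookup-index w∈ws)) ⟩
    w i′                                           ∎
    where
    l : Fin (length ws)
    l = index w∈ws

lookup-injective : ∀ {A : Set} {xs : List A} → Unique xs →
  ∀ p q → lookup xs p ≡ lookup xs q → p ≡ q
lookup-injective (_ ∷ _) zero zero _ = refl
lookup-injective (x∉xs ∷ _) zero (suc q) eq = ⊥-elim (All.lookup x∉xs (∈-lookup q) eq)
lookup-injective (x∉xs ∷ _) (suc p) zero eq = ⊥-elim (All.lookup x∉xs (∈-lookup p) (sym eq))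
lookup-injective (_ ∷ unique) (suc p) (suc q) eq = cong suc (lookup-injective unique p q eq)

missing? : ∀ {m n} (o : Orientation m n) (c : Fin (2 ^ m)) → Dec (¬ IsWord o (decode c))
missing? o c = ¬? (isWord? o (decode c))

missingCodes : ∀ {m n} → Orientation m n → List (Fin (2 ^ m))
missingCodes o = filter (missing? o) (allFin _)

missingWords : ∀ {m n} → Orientation m n → List (Word m)
missingWords o = map decode (missingCodes o)

-- Every word of W(K) occurs in missingWords, up to pointwise equality.
missingWords-complete : ∀ {m n} (o : Orientation m n) (w : Word m) → InW o w →
  decode (encode w) ∈ missingWords o
missingWords-complete o w w∈W =
  ∈-map⁺ decode (∈-filter⁺ (missing? o) (∈-allFin (encode w)) notWord)
  where
  notWord : ¬ IsWord o (decode (encode w))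
  notWord (y , same) = w∈W y λ j → trans (same j) (decode-encode w j)

-- With distinct words, |W(K)| + n ≤ 2 ^ m: the words of Y and the codes of
-- W(K) inject jointly into Fin (2 ^ m).
missingCodes-bound : ∀ {m n} (o : Orientation m n) → WordInjective o →
  n + length (missingCodes o) ≤ 2 ^ m
missingCodes-bound {m} {n} o injective = injective⇒≤ (splitAt-injective ∘ codeAll-injective)
  where
  codes : List (Fin (2 ^ m))
  codes = missingCodes o
  notWord : ∀ p → ¬ IsWord o (decode (lookup codes p))
  notWord p = proj₂ (∈-filter⁻ (missing? o) {xs = allFin _} (∈-lookup p))
  codeAll : Fin n ⊎ Fin (length codes) → Fin (2 ^ m)
  codeAll = [ encode ∘ wordOf o , lookup codes ]′
  decodes : ∀ y c → encode (wordOf o y) ≡ c → wordOf o y ≗ decode c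
  decodes y c eq j = trans (sym (decode-encode (wordOf o y) j)) (cong (λ c → decode c j) eq)
  codeAll-injective : ∀ {s s′} → codeAll s ≡ codeAll s′ → s ≡ s′
  codeAll-injective {inj₁ y} {inj₁ y′} eq = cong inj₁ (injective y y′ λ j →
    trans (decodes y _ eq j) (decode-encode (wordOf o y′) j))
  codeAll-injective {inj₁ y} {inj₂ p} eq = ⊥-elim (notWord p (y , decodes y _ eq))
  codeAll-injective {inj₂ p} {inj₁ y} eq = ⊥-elim (notWord p (y , decodes y _ (sym eq)))
  codeAll-injective {inj₂ p} {inj₂ q} eq =
    cong inj₂ (lookup-injective (Unique.filter⁺ (missing? o) (Unique.allFin⁺ _)) p q eq)
  splitAt-injective : ∀ {x x′} → splitAt n x ≡ splitAt n x′ → x ≡ x′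
  splitAt-injective = Injection.injective (↔⇒↣ +↔⊎)

missingWords-length : ∀ {m n} (o : Orientation m n) → WordInjective o →
  length (missingWords o) ≤ 2 ^ m ∸ n
missingWords-length {m} {n} o injective =
  ℕ.m+n≤o⇒m≤o∸n (length (missingWords o)) (begin
    length (missingWords o) + n   ≡⟨ cong (_+ n) (length-map (decode {m}) (missingCodes o)) ⟩
    length (missingCodes o) + n   ≡⟨ ℕ.+-comm (length (missingCodes o)) n ⟩
    n + length (missingCodes o)   ≤⟨ missingCodes-bound o injective ⟩
    2 ^ m                         ∎)
  where open ℕ.≤-Reasoning

missingWords-agree : ∀ {m n} (o : Orientation m n) {i i′ : Fin m} →
  (∀ {u} → u ∈ missingWords o → u i ≡ u i′) → ∀ w → InW o w → w i ≡ w i′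
missingWords-agree o {i} {i′} agree w w∈W = begin
  w i                   ≡⟨ sym (decode-encode w i) ⟩
  decode (encode w) i   ≡⟨ agree (missingWords-complete o w w∈W) ⟩
  decode (encode w) i′  ≡⟨ decode-encode w i′ ⟩
  w i′                  ∎
  where open ≡-Reasoning

fewMissing⇒¬Rigid : ∀ {m n} (o : Orientation m n) → WordInjective o →
  2 ^ length (missingWords o) < m → ¬ Rigid o
fewMissing⇒¬Rigid o injective small with columns-collide (missingWords o) small
... | i , i′ , i<i′ , agree =
  agreeingIndices⇒¬Rigid o injective (<⇒≢ i<i′) (missingWords-agree o agree)

noRigidOrientation : ∀ (m k : ℕ) → 2 ^ k < m → (o : Orientation m (2 ^ m ∸ k)) → ¬ Rigid o
noRigidOrientation m k small o with wordInjective-or-sameWord o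
... | inj₂ (y , y′ , y≢y′ , same) = sameWord⇒¬Rigid o y≢y′ same
... | inj₁ injective = fewMissing⇒¬Rigid o injective
  (ℕ.≤-<-trans (ℕ.^-monoʳ-≤ 2 (ℕ.≤-trans (missingWords-length o injective) atMostK)) small)
  where
  atMostK : 2 ^ m ∸ (2 ^ m ∸ k) ≤ k
  atMostK = ℕ.m≤n+o⇒m∸n≤o (2 ^ m) (2 ^ m ∸ k)
    (ℕ.≤-trans (ℕ.m≤n+m∸n (2 ^ m) k) (ℕ.≤-reflexive (ℕ.+-comm k (2 ^ m ∸ k))))

-- The theorem; the first claim does not need the bounds on m and n.
lemma21 : (∀ (m n : ℕ) → 3 ≤ m → m < n → n ≤ 2 ^ m →
    (o : Orientation m n) → NoFullTwins o →
    (∃[ i ] ∃[ i′ ] (i <ᶠ i′ × (∀ (w : Word m) → InW o w → w i ≡ w i′))) →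
    ¬ Rigid o)
    ×
    (∀ (m k : ℕ) → 3 ≤ m → 2 ^ k < m →
    (o : Orientation m (2 ^ m ∸ k)) → ¬ Rigid o)
lemma21 =
  (λ { m n _ _ _ o noTwins (i , i′ , i<i′ , agree) →
         agreeingIndices⇒¬Rigid o (noFullTwins⇒wordInjective o noTwins) (<⇒≢ i<i′) agree }) ,
  (λ m k _ → noRigidOrientation m k)
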